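{- Let $k\in \mathbb{Z}$ and $n,m\in\mathbb{Z}^+$ with $n\geq 2$, $k\not\equiv 0\pmod n$, and $m\geq 1$, and let $T_m$ be the rooted complete $m$-ary tree of infinite height. Then $\chi_{(n,k)}(T_m)=3$ if $(m+1,n)\mid k$, and $\chi_{(n,k)}(T_m)\in\{3,4\}$ otherwise.
   Context: $T_m$ is the infinite rooted tree in which every vertex has exactly $m$ children (so the root has degree $m$ and all other vertices degree $m+1$). $(a,b)$ denotes the greatest common divisor. For a graph $G=(V,E)$, a $\mathbb{Z}$-labeling is a map $\ell:V\to\mathbb{Z}$; its order is the size of its range; it is proper if adjacent vertices get different labels. $N(v)$ is the open neighborhood of $v$. An open coloring with remainder $k \bmod n$ is a labeling with $\sum_{w\in N(v)}\ell(w)\equiv k \pmod n$ for all $v\in V$. $\chi_{(n,k)}(G)$ is the minimum order of a proper open coloring with remainder $k\bmod n$ (when one of finite order exists). -}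

module Defs where

open import Data.Nat using (ℕ; zero; suc; _≤_)
open import Data.Integer using (ℤ; +_; _+_; _-_)
open import Data.Integer.Divisibility using (_∣_)
open import Data.Fin using (Fin; zero; suc)
open import Data.List using (List; []; _∷_)
open import Data.Product using (Σ; ∃; _×_; _,_)
open import Relation.Binary.PropositionalEquality using (_≡_; _≢_)
open import Function.Definitions using (Injective)

-- Vertices of the infinite rooted m-ary tree T_m: finite words over Fin m.
-- [] is the root; the children of v are (i ∷ v) for i : Fin m; the parent
-- of (i ∷ v) is v.  Edges are exactly {v , i ∷ v}.
Vertex : ℕ → Set
Vertex m = List (Fin m)

Labeling : ℕ → Set
Labeling m = Vertex m → ℤ

sumFin : (m : ℕ) → (Fin m → ℤ) → ℤ
sumFin zero    f = + 0
sumFin (suc m) f = f zero + sumFin m (λ i → f (suc i))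

nbrSum : (m : ℕ) → Labeling m → Vertex m → ℤ
nbrSum m ℓ []      = sumFin m (λ i → ℓ (i ∷ []))
nbrSum m ℓ (j ∷ v) = sumFin m (λ i → ℓ (i ∷ j ∷ v)) + ℓ v

Proper : (m : ℕ) → Labeling m → Set
Proper m ℓ = ∀ (v : Vertex m) (i : Fin m) → ℓ (i ∷ v) ≢ ℓ v

OpenColoring : (n : ℕ) (k : ℤ) (m : ℕ) → Labeling m → Set
OpenColoring n k m ℓ = ∀ (v : Vertex m) → (+ n) ∣ (nbrSum m ℓ v - k)

HasOrder : (m : ℕ) → Labeling m → ℕ → Set
HasOrder m ℓ c = Σ (Fin c → ℤ) λ f →
  Injective _≡_ _≡_ f
  × (∀ (v : Vertex m) → ∃ λ j → f j ≡ ℓ v)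
  × (∀ (j : Fin c) → ∃ λ (v : Vertex m) → ℓ v ≡ f j)

ProperOpenColoring : (n : ℕ) (k : ℤ) (m : ℕ) → Labeling m → Set
ProperOpenColoring n k m ℓ = Proper m ℓ × OpenColoring n k m ℓ

ChiIs : (n : ℕ) (k : ℤ) (m : ℕ) → ℕ → Set
ChiIs n k m c =
  (∃ λ (ℓ : Labeling m) → ProperOpenColoring n k m ℓ × HasOrder m ℓ c)
  × (∀ (ℓ : Labeling m) (d : ℕ) → ProperOpenColoring n k m ℓ → HasOrder m ℓ d → c ≤ d)

-- A labeling with two values cannot work: properness makes it alternate, and the neighbourhood
-- sums m·b at the root and m·b + b at a grandchild of the root (b the value on odd levels) force
-- n ∣ k. T_m has a total perfect code D (every vertex has exactly one neighbour in D). Putting k on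
-- D and 0 elsewhere, plus n on odd levels, gives an open colouring with four values; if
-- (m+1)·x ≡ k (mod n), which is solvable iff (m+1, n) ∣ k, then x on even levels and k or 0
-- (according to D) on odd levels gives one with three. Only values mod n matter, so congruent
-- values are pulled apart by adding multiples of n.
-- Whether a 3-colouring exists at all is decidable: up to values mod n, one is described by the
-- (parent colour, colour) pairs occurring on its edges together with how many children of each
-- colour a vertex gets, and conversely every such finite description unfolds into a colouring.
{-# OPTIONS --safe #-}
module Submission where

open import Defs
open import Data.Nat using (ℕ; _≤_)
open import Data.Nat.GCD using (gcd)
open import Data.Integer using (ℤ; +_)
open import Data.Integer.Divisibility using (_∣_)
open import Data.Product using (_×_)
open import Data.Sum using (_⊎_)
open import Relation.Nullary using (¬_)

open import Data.Bool using (Bool; true; false; not; if_then_else_; T; T?)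
open import Data.Bool.Properties using (not-involutive; if-float)
open import Data.Empty using (⊥-elim)
open import Data.Fin using (Fin; zero; suc; toℕ; fromℕ<; combine; punchIn; punchOut)
open import Data.Fin.Properties
  using (any?; all?; _≟_; toℕ<n; toℕ-injective; toℕ-fromℕ<; toℕ-combine; combine-injectiveˡ;
         punchIn-punchOut; punchInᵢ≢i)
open import Data.Fin.Subset using (Subset)
open import Data.Fin.Subset.Properties using (anySubset?)
open import Data.Integer using (+0; _+_; _-_; _*_; -_; ∣_∣)
open import Data.Integer.DivMod using (_%ℕ_; _/ℕ_; n%ℕd<d; a≡a%ℕn+[a/ℕn]*n)
import Data.Integer.Divisibility.Signed as Signed
import Data.Integer.Properties as ℤ
open import Data.Integer.Tactic.RingSolver using (solve-∀)
open import Data.List using ([]; _∷_)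
open import Data.Nat as ℕ using (zero; suc; _∸_; _<_; _<ᵇ_; _<?_; z≤n; s≤s; NonZero)
import Data.Nat.Divisibility as ℕ
open import Data.Nat.GCD using (gcd-GCD; module Bézout)
open Bézout.Identity using (+-; -+)
import Data.Nat.Properties as ℕ
open import Data.Product using (Σ; ∃; _,_; proj₁; proj₂)
import Data.Sum as Sum
open import Data.Sum using (inj₁; inj₂)
open import Data.Vec using (Vec; []; _∷_; lookup; tabulate)
open import Data.Vec.Properties using (lookup∘tabulate)
open import Function using (_∘_)
open import Function.Definitions using (Injective)
open import Relation.Binary.PropositionalEquality
  using (_≡_; _≢_; refl; sym; trans; cong; cong₂; subst; subst₂; module ≡-Reasoning)
open import Relation.Nullary using (Dec; yes; no)
open import Relation.Nullary.Decidable
  using (map′; toSum; isYes; toWitness; toWitnessFalse; fromWitness; _×-dec_; _→-dec_; ¬¬-excluded-middle)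
open import Relation.Nullary.Reflects using (ofʸ; ofⁿ)
open import Relation.Unary using (Decidable)

infix 4 _≡_mod_

-- Opaque, so that x and y can be inferred from a goal x ≡ y mod n.
opaque
  _≡_mod_ : ℤ → ℤ → ℕ → Set
  x ≡ y mod n = + n ∣ x - y

module _ {n : ℕ} where

  opaque
    unfolding _≡_mod_

    private
      via : ∀ x y {z} → x - y ≡ z → Signed._∣_ (+ n) z → x ≡ y mod n
      via x y eq n∣z = Signed.∣⇒∣ᵤ (subst (Signed._∣_ (+ n)) (sym eq) n∣z)

      signed : ∀ x y → x ≡ y mod n → Signed._∣_ (+ n) (x - y)
      signed x y = Signed.∣ᵤ⇒∣

    ∣⇒≡mod : ∀ {x y} → + n ∣ x - y → x ≡ y mod n
    ∣⇒≡mod n∣x-y = n∣x-y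

    ≡mod⇒∣ : ∀ {x y} → x ≡ y mod n → + n ∣ x - y
    ≡mod⇒∣ x≡y = x≡y

    ≡0⇒∣ : ∀ {x} → x ≡ +0 mod n → + n ∣ x
    ≡0⇒∣ {x} = subst (+ n ∣_) (ℤ.+-identityʳ x)

    infix 4 _≡?_mod
    _≡?_mod : ∀ x y → Dec (x ≡ y mod n)
    x ≡? y mod = n ℕ.∣? ∣ x - y ∣

    ≡⇒≡mod : ∀ {x y} → x ≡ y → x ≡ y mod n
    ≡⇒≡mod {x} refl = via x x (ℤ.+-inverseʳ x) (Signed.divides +0 refl)

    ≡mod-sym : ∀ {x y} → x ≡ y mod n → y ≡ x mod n
    ≡mod-sym {x} {y} x≡y = via y x (eq x y) (Signed.∣m⇒∣-m (signed x y x≡y))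
      where
      eq : ∀ x y → y - x ≡ - (x - y)
      eq = solve-∀

    ≡mod-trans : ∀ {x y z} → x ≡ y mod n → y ≡ z mod n → x ≡ z mod n
    ≡mod-trans {x} {y} {z} x≡y y≡z =
      via x z (eq x y z) (Signed.∣m∣n⇒∣m+n (signed x y x≡y) (signed y z y≡z))
      where
      eq : ∀ x y z → x - z ≡ (x - y) + (y - z)
      eq = solve-∀

    +-cong-mod : ∀ {a b c d} → a ≡ b mod n → c ≡ d mod n → a + c ≡ b + d mod n
    +-cong-mod {a} {b} {c} {d} a≡b c≡d =
      via (a + c) (b + d) (eq a b c d) (Signed.∣m∣n⇒∣m+n (signed a b a≡b) (signed c d c≡d))
      where
      eq : ∀ a b c d → (a + c) - (b + d) ≡ (a - b) + (c - d)
      eq = solve-∀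

    *-congˡ-mod : ∀ a {b c} → b ≡ c mod n → a * b ≡ a * c mod n
    *-congˡ-mod a {b} {c} b≡c = via (a * b) (a * c) (eq a b c) (Signed.∣n⇒∣m*n a (signed b c b≡c))
      where
      eq : ∀ a b c → a * b - a * c ≡ a * (b - c)
      eq = solve-∀

    +-cancelˡ-mod : ∀ a {b c} → a + b ≡ a + c mod n → b ≡ c mod n
    +-cancelˡ-mod a {b} {c} ab≡ac = via b c (eq a b c) (signed (a + b) (a + c) ab≡ac)
      where
      eq : ∀ a b c → b - c ≡ (a + b) - (a + c)
      eq = solve-∀

    +-multiple-mod : ∀ x q → x + q * + n ≡ x mod n
    +-multiple-mod x q = via (x + q * + n) x (eq x q (+ n)) (Signed.divides q refl)
      where
      eq : ∀ x q n → (x + q * n) - x ≡ q * n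
      eq = solve-∀

ℕ⇒ℤ-identity : ∀ a b c d e → a ℕ.+ b ℕ.* c ≡ d ℕ.* e → + a + + b * + c ≡ + d * + e
ℕ⇒ℤ-identity a b c d e eq = begin
  + a + + b * + c    ≡⟨ cong (_+_ (+ a)) (ℤ.pos-* b c) ⟨
  + a + + (b ℕ.* c)  ≡⟨ ℤ.pos-+ a (b ℕ.* c) ⟨
  + (a ℕ.+ b ℕ.* c)  ≡⟨ cong +_ eq ⟩
  + (d ℕ.* e)        ≡⟨ ℤ.pos-* d e ⟩
  + d * + e          ∎
  where open ≡-Reasoning

bézout-mod : ∀ a n → ∃ λ u → + a * u ≡ + gcd a n mod n
bézout-mod a n with Bézout.identity (gcd-GCD a n)
... | +- u v g+vn≡ua = + u , ≡mod-trans (≡⇒≡mod (begin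
  + a * + u        ≡⟨ ℤ.*-comm (+ a) (+ u) ⟩
  + u * + a        ≡⟨ ℕ⇒ℤ-identity (gcd a n) v n u a g+vn≡ua ⟨
  g + + v * + n    ∎)) (+-multiple-mod g (+ v))
  where
  open ≡-Reasoning
  g : ℤ
  g = + gcd a n
... | -+ u v g+ua≡vn = - + u , ≡mod-trans (≡⇒≡mod (begin
  + a * - + u            ≡⟨ ring₁ (+ a) (+ u) g ⟩
  g - (g + + u * + a)    ≡⟨ cong (_-_ g) (ℕ⇒ℤ-identity (gcd a n) u a v n g+ua≡vn) ⟩
  g - + v * + n          ≡⟨ ring₂ g (+ v) (+ n) ⟩
  g + - + v * + n        ∎)) (+-multiple-mod g (- + v))
  where
  open ≡-Reasoning
  g : ℤ
  g = + gcd a n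
  ring₁ : ∀ a u g → a * - u ≡ g - (g + u * a)
  ring₁ = solve-∀
  ring₂ : ∀ g v n → g - v * n ≡ g + - v * n
  ring₂ = solve-∀

linear-congruence : ∀ a n k → + gcd a n ∣ k → ∃ λ x → + a * x ≡ k mod n
linear-congruence a n k gcd∣k with Signed.∣ᵤ⇒∣ {+ gcd a n} {k} gcd∣k | bézout-mod a n
... | Signed.divides q k≡qg | u , au≡g = q * u , ≡mod-trans (≡⇒≡mod (swap (+ a) q u))
  (≡mod-trans (*-congˡ-mod q au≡g) (≡⇒≡mod (sym k≡qg)))
  where
  swap : ∀ a q u → a * (q * u) ≡ q * (a * u)
  swap = solve-∀

sumFin-cong : ∀ m {f g : Fin m → ℤ} → (∀ i → f i ≡ g i) → sumFin m f ≡ sumFin m g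
sumFin-cong zero    f≡g = refl
sumFin-cong (suc m) f≡g = cong₂ _+_ (f≡g zero) (sumFin-cong m (f≡g ∘ suc))

sumFin-cong-mod : ∀ {n} m {f g : Fin m → ℤ} → (∀ i → f i ≡ g i mod n) → sumFin m f ≡ sumFin m g mod n
sumFin-cong-mod zero    f≡g = ≡⇒≡mod refl
sumFin-cong-mod (suc m) f≡g = +-cong-mod (f≡g zero) (sumFin-cong-mod m (f≡g ∘ suc))

sumFin-const : ∀ m c → sumFin m (λ _ → c) ≡ + m * c
sumFin-const zero    c = refl
sumFin-const (suc m) c = trans (cong (_+_ c) (sumFin-const m c)) (sym (ℤ.suc-* (+ m) c))

count : ∀ {m} → (Fin m → Bool) → ℕ
count {zero}  h = 0
count {suc m} h = (if h zero then 1 else 0) ℕ.+ count (h ∘ suc)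

count≤ : ∀ {m} (h : Fin m → Bool) → count h ≤ m
count≤ {zero}  h = z≤n
count≤ {suc m} h with h zero
... | true  = s≤s (count≤ (h ∘ suc))
... | false = ℕ.m≤n⇒m≤1+n (count≤ (h ∘ suc))

count>0⇒∃ : ∀ {m} (h : Fin m → Bool) → 0 < count h → ∃ λ i → T (h i)
count>0⇒∃ {suc m} h positive with h zero in eq
... | true  = zero , subst T (sym eq) _
... | false = let (i , hi) = count>0⇒∃ (h ∘ suc) positive in suc i , hi

count<⇒∃ : ∀ {m} (h : Fin m → Bool) → count h < m → ∃ λ i → T (not (h i))
count<⇒∃ {suc m} h below with h zero in eq
... | false = zero , subst (T ∘ not) (sym eq) _
... | true  = let (i , hi) = count<⇒∃ (h ∘ suc) (ℕ.≤-pred below) in suc i , hi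

count-<ᵇ : ∀ {m} a → a ≤ m → count {m} (λ i → toℕ i <ᵇ a) ≡ a
count-<ᵇ {zero}  zero    _         = refl
count-<ᵇ {suc m} zero    _         = count-<ᵇ {m} zero z≤n
count-<ᵇ {suc m} (suc a) (s≤s a≤m) = cong suc (count-<ᵇ a a≤m)

sumFin-if : ∀ {m} (h : Fin m → Bool) a b →
  sumFin m (λ i → if h i then a else b) ≡ + count h * a + + (m ∸ count h) * b
sumFin-if {zero}  h a b = refl
sumFin-if {suc m} h a b with h zero | sumFin-if (h ∘ suc) a b | count≤ (h ∘ suc)
... | true  | ih | _   = begin
  a + sumFin m (λ i → if h (suc i) then a else b)  ≡⟨ cong (_+_ a) ih ⟩
  a + (+ c * a + + (m ∸ c) * b)                    ≡⟨ ℤ.+-assoc a _ _ ⟨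
  (a + + c * a) + + (m ∸ c) * b                    ≡⟨ cong (_+ _) (ℤ.suc-* (+ c) a) ⟨
  + suc c * a + + (m ∸ c) * b                      ∎
  where
  open ≡-Reasoning
  c : ℕ
  c = count (h ∘ suc)
... | false | ih | c≤m = begin
  b + sumFin m (λ i → if h (suc i) then a else b)  ≡⟨ cong (_+_ b) ih ⟩
  b + (+ c * a + + (m ∸ c) * b)                    ≡⟨ swap b (+ c * a) _ ⟩
  + c * a + (b + + (m ∸ c) * b)                    ≡⟨ cong (_+_ (+ c * a)) (ℤ.suc-* (+ (m ∸ c)) b) ⟨
  + c * a + + suc (m ∸ c) * b                      ≡⟨ cong (λ d → + c * a + + d * b) (ℕ.+-∸-assoc 1 c≤m) ⟨
  + c * a + + (suc m ∸ c) * b                      ∎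
  where
  open ≡-Reasoning
  c : ℕ
  c = count (h ∘ suc)
  swap : ∀ x y z → x + (y + z) ≡ y + (x + z)
  swap = solve-∀

module _ (n : ℕ) .{{_ : NonZero n}} where

  residue : ℤ → Fin n
  residue z = fromℕ< (n%ℕd<d z n)

  residue-≡ : ∀ z → + toℕ (residue z) ≡ z mod n
  residue-≡ z = subst₂ (λ r z → r ≡ z mod n) (cong +_ (sym (toℕ-fromℕ< _))) (sym (a≡a%ℕn+[a/ℕn]*n z n))
    (≡mod-sym (+-multiple-mod (+ (z %ℕ n)) (z /ℕ n)))

  -- Pairwise distinct representatives of the values of g: the residue of g j plus n · j.
  lift : ∀ {c} → (Fin c → ℤ) → Fin c → ℤ
  lift g j = + toℕ (combine j (residue (g j)))

  lift-injective : ∀ {c} (g : Fin c → ℤ) → Injective _≡_ _≡_ (lift g)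
  lift-injective g {i} {j} eq =
    combine-injectiveˡ i (residue (g i)) j (residue (g j)) (toℕ-injective (ℤ.+-injective eq))

  lift-≡ : ∀ {c} (g : Fin c → ℤ) j → lift g j ≡ g j mod n
  lift-≡ g j = ≡mod-trans (subst (_≡ r mod n) (sym lift≡) (+-multiple-mod r (+ toℕ j))) (residue-≡ (g j))
    where
    r : ℤ
    r = + toℕ (residue (g j))
    lift≡ : lift g j ≡ r + + toℕ j * + n
    lift≡ = begin
      + toℕ (combine j (residue (g j)))        ≡⟨ cong +_ (toℕ-combine j (residue (g j))) ⟩
      + (n ℕ.* toℕ j ℕ.+ toℕ (residue (g j)))  ≡⟨ ℤ.pos-+ (n ℕ.* toℕ j) _ ⟩
      + (n ℕ.* toℕ j) + r                      ≡⟨ cong (_+ r) (ℤ.pos-* n (toℕ j)) ⟩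
      + n * + toℕ j + r                        ≡⟨ ℤ.+-comm (+ n * + toℕ j) r ⟩
      r + + n * + toℕ j                        ≡⟨ cong (_+_ r) (ℤ.*-comm (+ n) (+ toℕ j)) ⟩
      r + + toℕ j * + n                        ∎
      where open ≡-Reasoning

Searchable : Set → Set₁
Searchable A = ∀ {P : A → Set} → Decidable P → Dec (∃ P)

searchVec : ∀ {A k} → Searchable A → Searchable (Vec A k)
searchVec {k = zero}  search P? = map′ ([] ,_) (λ { ([] , p) → p }) (P? [])
searchVec {k = suc k} search P? = map′ (λ (a , as , p) → a ∷ as , p) (λ { (a ∷ as , p) → a , as , p })
  (search λ a → searchVec search (P? ∘ (a ∷_)))

¬¬-∀Fin : ∀ {k} {P : Fin k → Set} → (∀ i → ¬ ¬ P i) → ¬ ¬ (∀ i → P i)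
¬¬-∀Fin {zero}  _   ¬all = ¬all λ ()
¬¬-∀Fin {suc k} ¬¬P ¬all = ¬¬P zero λ p₀ → ¬¬-∀Fin (¬¬P ∘ suc) λ rest → ¬all λ { zero → p₀ ; (suc i) → rest i }

other₀ other₁ : Fin 3 → Fin 3
other₀ s = punchIn s zero
other₁ s = punchIn s (suc zero)

others : ∀ {s t} → t ≢ s → t ≡ other₀ s ⊎ t ≡ other₁ s
others t≢s with punchOut (t≢s ∘ sym) | punchIn-punchOut (t≢s ∘ sym)
... | zero     | eq = inj₁ (sym eq)
... | suc zero | eq = inj₂ (sym eq)

≢other₀⇒≡other₁ : ∀ {s t} → t ≢ s → t ≢ other₀ s → t ≡ other₁ s
≢other₀⇒≡other₁ t≢s t≢other₀ = Sum.[ ⊥-elim ∘ t≢other₀ , (λ t≡other₁ → t≡other₁) ] (others t≢s)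

module _ {m : ℕ} where

  odd : Vertex m → Bool
  odd []      = false
  odd (_ ∷ v) = not (odd v)

  parentValue : Labeling m → Vertex m → ℤ
  parentValue ℓ []      = +0
  parentValue ℓ (_ ∷ v) = ℓ v

  AdjacentDistinct : {A : Set} → (Vertex m → A) → Set
  AdjacentDistinct σ = ∀ v i → σ (i ∷ v) ≢ σ v

  nbrSum-split : ∀ (ℓ : Labeling m) v → nbrSum m ℓ v ≡ sumFin m (λ i → ℓ (i ∷ v)) + parentValue ℓ v
  nbrSum-split ℓ []      = sym (ℤ.+-identityʳ _)
  nbrSum-split ℓ (_ ∷ v) = refl

  nbrSum-cong-mod : ∀ {n} {ℓ ℓ′ : Labeling m} → (∀ w → ℓ w ≡ ℓ′ w mod n) →
    ∀ v → nbrSum m ℓ v ≡ nbrSum m ℓ′ v mod n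
  nbrSum-cong-mod ℓ≡ℓ′ []      = sumFin-cong-mod m (λ i → ℓ≡ℓ′ (i ∷ []))
  nbrSum-cong-mod ℓ≡ℓ′ (j ∷ v) = +-cong-mod (sumFin-cong-mod m (λ i → ℓ≡ℓ′ (i ∷ j ∷ v))) (ℓ≡ℓ′ v)

  nbrSum-cong-oppositeParity : ∀ {ℓ ℓ′ : Labeling m} v → (∀ w → odd w ≡ not (odd v) → ℓ w ≡ ℓ′ w) →
    nbrSum m ℓ v ≡ nbrSum m ℓ′ v
  nbrSum-cong-oppositeParity []      ℓ≡ℓ′ = sumFin-cong m (λ i → ℓ≡ℓ′ (i ∷ []) refl)
  nbrSum-cong-oppositeParity (j ∷ v) ℓ≡ℓ′ =
    cong₂ _+_ (sumFin-cong m (λ i → ℓ≡ℓ′ (i ∷ j ∷ v) refl)) (ℓ≡ℓ′ v (sym (not-involutive (odd v))))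

module _ {m′ : ℕ} where

  -- A total perfect code of T_m: every vertex has exactly one neighbour in it, namely its
  -- parent if the parent is in the code, and its first child otherwise.
  inCode : Vertex (suc m′) → Bool
  inCode []             = false
  inCode (suc _ ∷ _)    = false
  inCode (zero ∷ [])    = true
  inCode (zero ∷ _ ∷ v) = not (inCode v)

  codeValue : ℤ → Labeling (suc m′)
  codeValue a w = if inCode w then a else +0

  sumFin-children-codeValue : ∀ a v → sumFin (suc m′) (λ i → codeValue a (i ∷ v)) ≡ codeValue a (zero ∷ v)
  sumFin-children-codeValue a v = begin
    codeValue a (zero ∷ v) + sumFin m′ (λ _ → +0)  ≡⟨ cong (_+_ (codeValue a (zero ∷ v))) (sumFin-const m′ +0) ⟩
    codeValue a (zero ∷ v) + + m′ * +0             ≡⟨ cong (_+_ (codeValue a (zero ∷ v))) (ℤ.*-zeroʳ (+ m′)) ⟩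
    codeValue a (zero ∷ v) + +0                    ≡⟨ ℤ.+-identityʳ _ ⟩
    codeValue a (zero ∷ v)                         ∎
    where open ≡-Reasoning

  nbrSum-codeValue : ∀ a v → nbrSum (suc m′) (codeValue a) v ≡ a
  nbrSum-codeValue a []      = sumFin-children-codeValue a []
  nbrSum-codeValue a (j ∷ v) =
    trans (cong (_+ codeValue a v) (sumFin-children-codeValue a (j ∷ v))) (exactly-one (inCode v))
    where
    exactly-one : ∀ b → (if not b then a else +0) + (if b then a else +0) ≡ a
    exactly-one true  = ℤ.+-identityˡ a
    exactly-one false = ℤ.+-identityʳ a

module Colourings (n : ℕ) .{{_ : NonZero n}} (k : ℤ) (m′ : ℕ) where

  private
    m : ℕ
    m = suc m′

  -- A proper open colouring, except that distinct colours may carry equal values.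
  record Pattern (c : ℕ) : Set where
    field
      colour            : Vertex m → Fin c
      value             : Fin c → ℤ
      adjacent-distinct : AdjacentDistinct colour
      open-colouring    : OpenColoring n k m (value ∘ colour)

  patternOf : ∀ {ℓ c} → ProperOpenColoring n k m ℓ → HasOrder m ℓ c → Pattern c
  patternOf {ℓ} {c} (proper , open-ℓ) (f , _ , cover , _) = record
    { colour            = colour
    ; value             = f
    ; adjacent-distinct = λ v i same → proper v i (trans (sym (value≡ (i ∷ v))) (trans (cong f same) (value≡ v)))
    ; open-colouring    = λ v → ≡mod⇒∣ (≡mod-trans (nbrSum-cong-mod (≡⇒≡mod ∘ value≡) v) (∣⇒≡mod (open-ℓ v)))
    }
    where
    colour : Vertex m → Fin c
    colour = proj₁ ∘ cover
    value≡ : ∀ v → f (colour v) ≡ ℓ v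
    value≡ = proj₂ ∘ cover

  module _ {c} (P : Pattern c) where
    open Pattern P

    lifted : Labeling m
    lifted = lift n value ∘ colour

    lifted-proper-open : ProperOpenColoring n k m lifted
    lifted-proper-open = (λ v i same → adjacent-distinct v i (lift-injective n value same))
      , λ v → ≡mod⇒∣ (≡mod-trans (nbrSum-cong-mod (lift-≡ n value ∘ colour) v) (∣⇒≡mod (open-colouring v)))

    lifted-order : (∀ j → ∃ λ v → colour v ≡ j) → HasOrder m lifted c
    lifted-order surjective = lift n value , lift-injective n value , (λ v → colour v , refl)
      , λ j → let (v , colour≡j) = surjective j in v , cong (lift n value) colour≡j

  NearRoot : (Vertex m → Set) → Set
  NearRoot P = P [] × (∀ i → P (i ∷ [])) × P (zero ∷ zero ∷ []) × (∀ i → P (i ∷ zero ∷ zero ∷ []))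

  all⇒nearRoot : ∀ {P : Vertex m → Set} → (∀ v → P v) → NearRoot P
  all⇒nearRoot p = p [] , p ∘ (_∷ []) , p (zero ∷ zero ∷ []) , p ∘ (_∷ zero ∷ zero ∷ [])

  nearRoot-map : ∀ {P Q : Vertex m → Set} → (∀ v → P v → Q v) → NearRoot P → NearRoot Q
  nearRoot-map f (p₀ , p₁ , p₂ , p₃) = f _ p₀ , (λ i → f _ (p₁ i)) , f _ p₂ , λ i → f _ (p₃ i)

  search-nearRoot : ∀ {P : Vertex m → Set} → Decidable P → ∃ P ⊎ NearRoot (¬_ ∘ P)
  search-nearRoot P? with P? [] | any? (P? ∘ (_∷ [])) | P? (zero ∷ zero ∷ []) | any? (P? ∘ (_∷ zero ∷ zero ∷ []))
  ... | yes p  | _           | _      | _           = inj₁ (_ , p)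
  ... | _      | yes (_ , p) | _      | _           = inj₁ (_ , p)
  ... | _      | _           | yes p  | _           = inj₁ (_ , p)
  ... | _      | _           | _      | yes (_ , p) = inj₁ (_ , p)
  ... | no ¬p₀ | no ¬p₁      | no ¬p₂ | no ¬p₃      = inj₂ (¬p₀ , (λ i p → ¬p₁ (i , p)) , ¬p₂ , λ i p → ¬p₃ (i , p))

  OneOf : ℤ → ℤ → ℤ → Set
  OneOf x y t = t ≡ x ⊎ t ≡ y

  oneOf-other : ∀ {x y a t t′} → OneOf x y a → OneOf x y t → OneOf x y t′ → t ≢ a → t′ ≢ a → t ≡ t′
  oneOf-other (inj₁ refl) (inj₁ refl) _           t≢a _    = ⊥-elim (t≢a refl)
  oneOf-other (inj₁ refl) (inj₂ _)    (inj₁ refl) _   t′≢a = ⊥-elim (t′≢a refl)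
  oneOf-other (inj₁ refl) (inj₂ refl) (inj₂ refl) _   _    = refl
  oneOf-other (inj₂ refl) (inj₂ refl) _           t≢a _    = ⊥-elim (t≢a refl)
  oneOf-other (inj₂ refl) (inj₁ _)    (inj₂ refl) _   t′≢a = ⊥-elim (t′≢a refl)
  oneOf-other (inj₂ refl) (inj₁ refl) (inj₁ refl) _   _    = refl

  -- Properness forces the value b of the first child of the root onto all children of the root
  -- and of 0 ∷ 0 ∷ [], so the neighbourhood sums there are m·b and m·b + b.
  twoValued⇒∣ : ∀ {ℓ x y} → ProperOpenColoring n k m ℓ → NearRoot (OneOf x y ∘ ℓ) → + n ∣ k
  twoValued⇒∣ {ℓ} (proper , open-ℓ) (at-root , at-children , at-00 , at-grandchildren) =
    ≡0⇒∣ (≡mod-trans (≡mod-sym root-sum) (≡mod-trans (*-congˡ-mod (+ m) b≡0) (≡⇒≡mod (ℤ.*-zeroʳ (+ m)))))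
    where
    b : ℤ
    b = ℓ (zero ∷ [])
    children≡b : ∀ i → ℓ (i ∷ []) ≡ b
    children≡b i = oneOf-other at-root (at-children i) (at-children zero) (proper [] i) (proper [] zero)
    grandchildren≡b : ∀ i → ℓ (i ∷ zero ∷ zero ∷ []) ≡ b
    grandchildren≡b i = oneOf-other at-00 (at-grandchildren i) (at-children zero)
                          (proper (zero ∷ zero ∷ []) i) (proper (zero ∷ []) zero ∘ sym)
    root-sum : + m * b ≡ k mod n
    root-sum = subst (_≡ k mod n) (trans (sumFin-cong m children≡b) (sumFin-const m b)) (∣⇒≡mod (open-ℓ []))
    00-sum : + m * b + b ≡ k mod n
    00-sum = subst (λ s → s + b ≡ k mod n) (trans (sumFin-cong m grandchildren≡b) (sumFin-const m b))
               (∣⇒≡mod (open-ℓ (zero ∷ zero ∷ [])))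
    b≡0 : b ≡ +0 mod n
    b≡0 = +-cancelˡ-mod (+ m * b)
            (≡mod-trans 00-sum (≡mod-trans (≡mod-sym root-sum) (≡⇒≡mod (sym (ℤ.+-identityʳ _)))))

  atMostTwoValues : ∀ {d} → d ≤ 2 → (f : Fin d → ℤ) → Σ ℤ λ x → Σ ℤ λ y → ∀ j → OneOf x y (f j)
  atMostTwoValues {0} _ f = +0 , +0 , λ ()
  atMostTwoValues {1} _ f = f zero , f zero , λ { zero → inj₁ refl }
  atMostTwoValues {2} _ f = f zero , f (suc zero) , λ { zero → inj₁ refl ; (suc zero) → inj₂ refl }
  atMostTwoValues {suc (suc (suc _))} (s≤s (s≤s ())) _

  order≥3 : ¬ + n ∣ k → ∀ {ℓ d} → ProperOpenColoring n k m ℓ → HasOrder m ℓ d → 3 ≤ d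
  order≥3 n∤k {ℓ} {d} poc (f , _ , cover , _) with d ℕ.≤? 2
  ... | no d≰2  = ℕ.≰⇒> d≰2
  ... | yes d≤2 = ⊥-elim (n∤k (twoValued⇒∣ poc (all⇒nearRoot values)))
    where
    values : ∀ v → OneOf _ _ (ℓ v)
    values v = let (j , f≡ℓ) = cover v in subst (OneOf _ _) f≡ℓ (proj₂ (proj₂ (atMostTwoValues d≤2 f)) j)

  pattern₃-surjective : ¬ + n ∣ k → (P : Pattern 3) → ∀ j → ∃ λ v → Pattern.colour P v ≡ j
  pattern₃-surjective n∤k P j with search-nearRoot (λ v → Pattern.colour P v ≟ j)
  ... | inj₁ found   = found
  ... | inj₂ missing = ⊥-elim (n∤k (twoValued⇒∣ (lifted-proper-open P) (nearRoot-map other-value missing)))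
    where
    open Pattern P
    other-value : ∀ v → colour v ≢ j → OneOf (lift n value (other₀ j)) (lift n value (other₁ j)) (lifted P v)
    other-value v colour≢j = Sum.map (cong (lift n value)) (cong (lift n value)) (others colour≢j)

  pattern₃⇒colouring : ¬ + n ∣ k → Pattern 3 → ∃ λ ℓ → ProperOpenColoring n k m ℓ × HasOrder m ℓ 3
  pattern₃⇒colouring n∤k P = lifted P , lifted-proper-open P , lifted-order P (pattern₃-surjective n∤k P)

  childLabel : Fin 3 → ℕ → Fin m → Fin 3
  childLabel s a i = punchIn s (if toℕ i <ᵇ a then zero else suc zero)

  childSum : (Fin 3 → ℤ) → Fin 3 → ℕ → ℤ
  childSum L s a = + a * L (other₀ s) + + (m ∸ a) * L (other₁ s)

  sumFin-childLabel : ∀ L s {a} → a ≤ m → sumFin m (λ i → L (childLabel s a i)) ≡ childSum L s a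
  sumFin-childLabel L s {a} a≤m = begin
    sumFin m (λ i → L (childLabel s a i))
      ≡⟨ sumFin-cong m (λ i → if-float (L ∘ punchIn s) (toℕ i <ᵇ a) {zero} {suc zero}) ⟩
    sumFin m (λ i → if toℕ i <ᵇ a then L (other₀ s) else L (other₁ s))
      ≡⟨ sumFin-if (λ i → toℕ i <ᵇ a) _ _ ⟩
    childSum L s (count {m} (λ i → toℕ i <ᵇ a))
      ≡⟨ cong (childSum L s) (count-<ᵇ a a≤m) ⟩
    childSum L s a ∎
    where open ≡-Reasoning

  ChildrenAllowed : (Fin 3 → Fin 3 → Set) → Fin 3 → ℕ → Set
  ChildrenAllowed E s a = (0 < a → E s (other₀ s)) × (a < m → E s (other₁ s))

  childLabel-allowed : ∀ {E s a} → ChildrenAllowed E s a → ∀ i → E s (childLabel s a i)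
  childLabel-allowed {a = a} (first , second) i with toℕ i <ᵇ a | ℕ.<ᵇ-reflects-< (toℕ i) a
  ... | true  | ofʸ i<a = first (ℕ.≤-<-trans z≤n i<a)
  ... | false | ofⁿ i≮a = second (ℕ.≤-<-trans (ℕ.≮⇒≥ i≮a) (toℕ<n i))

  Fits : (Fin 3 → ℤ) → (Fin 3 → Fin 3 → Set) → Fin 3 → ℤ → Set
  Fits L E s p = ∃ λ a → a < suc m × childSum L s a + p ≡ k mod n × ChildrenAllowed E s a

  -- A finite description of a 3-pattern with colour values L: E p s allows a vertex of colour s
  -- below one of colour p, and Fits L E s p says how many children (the first a) get other₀ s
  -- when the parent contributes p to the neighbourhood sum.
  Scheme : (Fin 3 → ℤ) → (Fin 3 → Fin 3 → Set) → Set
  Scheme L E = (∀ p s → E p s → Fits L E s (L p)) × ∃ λ r → Fits L E r +0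

  module SchemePattern {L E} (scheme : Scheme L E) where

    record Node : Set where
      field
        label : Fin 3
        above : ℤ
        fits  : Fits L E label above

    child : Node → Fin m → Node
    child node i = let (a , _ , _ , allowed) = fits in record
      { label = childLabel label a i
      ; above = L label
      ; fits  = proj₁ scheme label (childLabel label a i) (childLabel-allowed {E} allowed i)
      }
      where open Node node

    node : Vertex m → Node
    node []      = record { label = proj₁ (proj₂ scheme) ; above = +0 ; fits = proj₂ (proj₂ scheme) }
    node (i ∷ v) = child (node v) i

    colour : Vertex m → Fin 3
    colour = Node.label ∘ node

    parentValue≡above : ∀ v → parentValue (L ∘ colour) v ≡ Node.above (node v)
    parentValue≡above []      = refl
    parentValue≡above (_ ∷ _) = refl

    open-at : ∀ v → nbrSum m (L ∘ colour) v ≡ k mod n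
    open-at v = let (a , a<1+m , fit , _) = Node.fits (node v) in subst (_≡ k mod n)
      (sym (trans (nbrSum-split (L ∘ colour) v)
                  (cong₂ _+_ (sumFin-childLabel L (colour v) (ℕ.≤-pred a<1+m)) (parentValue≡above v))))
      fit

    schemePattern : Pattern 3
    schemePattern = record
      { colour            = colour
      ; value             = L
      ; adjacent-distinct = λ v i → punchInᵢ≢i (colour v) _
      ; open-colouring    = ≡mod⇒∣ ∘ open-at
      }

  module PatternScheme (P : Pattern 3) where
    open Pattern P

    Realised : Fin 3 → Fin 3 → Set
    Realised p s = Σ (Vertex m) λ v → Σ (Fin m) λ i → colour v ≡ p × colour (i ∷ v) ≡ s

    fits-at : ∀ w → Fits value Realised (colour w) (parentValue (value ∘ colour) w)
    fits-at w = count isOther₀ , s≤s (count≤ isOther₀) , sum≡k , first-realised , second-realised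
      where
      s : Fin 3
      s = colour w
      isOther₀ : Fin m → Bool
      isOther₀ i = isYes (colour (i ∷ w) ≟ other₀ s)

      child-value : ∀ i → value (colour (i ∷ w)) ≡ (if isOther₀ i then value (other₀ s) else value (other₁ s))
      child-value i with colour (i ∷ w) ≟ other₀ s
      ... | yes same    = cong value same
      ... | no  differs = cong value (≢other₀⇒≡other₁ (adjacent-distinct w i) differs)

      sum≡k : childSum value s (count isOther₀) + parentValue (value ∘ colour) w ≡ k mod n
      sum≡k = subst (_≡ k mod n) (trans (nbrSum-split (value ∘ colour) w)
                (cong (_+ parentValue (value ∘ colour) w) (trans (sumFin-cong m child-value) (sumFin-if isOther₀ _ _))))
                (∣⇒≡mod (open-colouring w))

      first-realised : 0 < count isOther₀ → Realised s (other₀ s)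
      first-realised positive = let (i , is-other₀) = count>0⇒∃ isOther₀ positive in
        w , i , refl , toWitness {a? = colour (i ∷ w) ≟ other₀ s} is-other₀

      second-realised : count isOther₀ < m → Realised s (other₁ s)
      second-realised below = let (i , not-other₀) = count<⇒∃ isOther₀ below in
        w , i , refl , ≢other₀⇒≡other₁ (adjacent-distinct w i) (toWitnessFalse {a? = colour (i ∷ w) ≟ other₀ s} not-other₀)

    realisedScheme : Scheme value Realised
    realisedScheme = (λ { p s (v , i , refl , refl) → fits-at (i ∷ v) }) , colour [] , fits-at []

  module _ {L L′ : Fin 3 → ℤ} {E E′ : Fin 3 → Fin 3 → Set} (L≡L′ : ∀ j → L j ≡ L′ j mod n) where

    childSum-cong : ∀ s a → childSum L s a ≡ childSum L′ s a mod n
    childSum-cong s a = +-cong-mod (*-congˡ-mod (+ a) (L≡L′ (other₀ s))) (*-congˡ-mod (+ (m ∸ a)) (L≡L′ (other₁ s)))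

    fits-resp : (∀ {p s} → E p s → E′ p s) → ∀ {s p p′} → p ≡ p′ mod n → Fits L E s p → Fits L′ E′ s p′
    fits-resp E⇒E′ {s} p≡p′ (a , a<1+m , fit , first , second) =
      a , a<1+m , ≡mod-trans (+-cong-mod (≡mod-sym (childSum-cong s a)) (≡mod-sym p≡p′)) fit , E⇒E′ ∘ first , E⇒E′ ∘ second

    scheme-resp : (∀ {p s} → E p s → E′ p s) → (∀ {p s} → E′ p s → E p s) → Scheme L E → Scheme L′ E′
    scheme-resp E⇒E′ E′⇒E (closed , r , root-fits) =
      (λ p s e′ → fits-resp E⇒E′ (L≡L′ p) (closed p s (E′⇒E e′))) , r , fits-resp E⇒E′ (≡⇒≡mod refl) root-fits

  fits? : ∀ L {E} → (∀ p s → Dec (E p s)) → ∀ s p → Dec (Fits L E s p)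
  fits? L E? s p = ℕ.anyUpTo? (λ a → (childSum L s a + p ≡? k mod)
                                        ×-dec ((0 <? a) →-dec E? s (other₀ s))
                                        ×-dec ((a <? m) →-dec E? s (other₁ s)))
                              (suc m)

  scheme? : ∀ L {E} → (∀ p s → Dec (E p s)) → Dec (Scheme L E)
  scheme? L E? = all? (λ p → all? λ s → E? p s →-dec fits? L E? s (L p)) ×-dec any? (λ r → fits? L E? r +0)

  valueOf : Vec (Fin n) 3 → Fin 3 → ℤ
  valueOf R j = + toℕ (lookup R j)

  edgesOf : Vec (Subset 3) 3 → Fin 3 → Fin 3 → Set
  edgesOf S p s = T (lookup (lookup S p) s)

  FiniteScheme : Set
  FiniteScheme = Σ (Vec (Fin n) 3) λ R → Σ (Vec (Subset 3) 3) λ S → Scheme (valueOf R) (edgesOf S)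

  finiteScheme? : Dec FiniteScheme
  finiteScheme? = searchVec any? λ R → searchVec anySubset? λ S → scheme? (valueOf R) (λ p s → T? _)

  finiteScheme⇒pattern : FiniteScheme → Pattern 3
  finiteScheme⇒pattern (_ , _ , scheme) = SchemePattern.schemePattern scheme

  -- Realised is not decidable, but refuting ¬ FiniteScheme only needs its decidability under ¬ ¬.
  pattern⇒¬¬finiteScheme : Pattern 3 → ¬ ¬ FiniteScheme
  pattern⇒¬¬finiteScheme P no-scheme = ¬¬-∀Fin (λ p → ¬¬-∀Fin λ s → ¬¬-excluded-middle) λ realised? →
    no-scheme (R , S realised? , scheme-resp residues (to realised?) (from realised?) realisedScheme)
    where
    open Pattern P
    open PatternScheme P
    R : Vec (Fin n) 3
    R = tabulate (residue n ∘ value)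
    residues : ∀ j → value j ≡ valueOf R j mod n
    residues j = ≡mod-sym (subst (λ r → + toℕ r ≡ value j mod n) (sym (lookup∘tabulate (residue n ∘ value) j))
                                 (residue-≡ n (value j)))
    S : (∀ p s → Dec (Realised p s)) → Vec (Subset 3) 3
    S realised? = tabulate λ p → tabulate λ s → isYes (realised? p s)
    lookup-S : ∀ realised? p s → lookup (lookup (S realised?) p) s ≡ isYes (realised? p s)
    lookup-S realised? p s = trans (cong (λ row → lookup row s) (lookup∘tabulate (λ p → tabulate λ s → isYes (realised? p s)) p))
                                   (lookup∘tabulate (λ s → isYes (realised? p s)) s)
    to : ∀ realised? {p s} → Realised p s → edgesOf (S realised?) p s
    to realised? {p} {s} r = subst T (sym (lookup-S realised? p s)) (fromWitness r)
    from : ∀ realised? {p s} → edgesOf (S realised?) p s → Realised p s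
    from realised? {p} {s} e = toWitness (subst T (lookup-S realised? p s) e)

  encode : Bool → Bool → Fin 4
  encode false false = zero
  encode false true  = suc zero
  encode true  false = suc (suc zero)
  encode true  true  = suc (suc (suc zero))

  encode-flip : ∀ b b′ p → encode b (not p) ≢ encode b′ p
  encode-flip false false false ()
  encode-flip false false true  ()
  encode-flip false true  false ()
  encode-flip false true  true  ()
  encode-flip true  false false ()
  encode-flip true  false true  ()
  encode-flip true  true  false ()
  encode-flip true  true  true  ()

  value₄ : Fin 4 → ℤ
  value₄ zero                   = +0
  value₄ (suc zero)             = +0
  value₄ (suc (suc zero))       = k
  value₄ (suc (suc (suc zero))) = k

  value₄-encode : ∀ b p → value₄ (encode b p) ≡ (if b then k else +0)
  value₄-encode false false = refl
  value₄-encode false true  = refl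
  value₄-encode true  false = refl
  value₄-encode true  true  = refl

  fourPattern : Pattern 4
  fourPattern = record
    { colour            = colour₄
    ; value             = value₄
    ; adjacent-distinct = λ v i → encode-flip _ _ (odd v)
    ; open-colouring    = λ v → ≡mod⇒∣ (≡mod-trans
        (nbrSum-cong-mod (λ w → ≡⇒≡mod (value₄-encode (inCode w) (odd w))) v) (≡⇒≡mod (nbrSum-codeValue k v)))
    }
    where
    colour₄ : Vertex m → Fin 4
    colour₄ w = encode (inCode w) (odd w)

  fourPattern-surjective : ∀ j → ∃ λ v → Pattern.colour fourPattern v ≡ j
  fourPattern-surjective zero                   = [] , refl
  fourPattern-surjective (suc zero)             = zero ∷ zero ∷ zero ∷ [] , refl
  fourPattern-surjective (suc (suc zero))       = zero ∷ zero ∷ [] , refl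
  fourPattern-surjective (suc (suc (suc zero))) = zero ∷ [] , refl

  label₃ : Bool → Bool → Fin 3
  label₃ false _     = zero
  label₃ true  true  = suc zero
  label₃ true  false = suc (suc zero)

  label₃-flip : ∀ p c c′ → label₃ (not p) c ≢ label₃ p c′
  label₃-flip false true  _     ()
  label₃-flip false false _     ()
  label₃-flip true  _     true  ()
  label₃-flip true  _     false ()

  module _ (x : ℤ) (x-solves : + suc m * x ≡ k mod n) where

    value₃ : Fin 3 → ℤ
    value₃ zero             = x
    value₃ (suc zero)       = k
    value₃ (suc (suc zero)) = +0

    colour₃ : Vertex m → Fin 3
    colour₃ w = label₃ (odd w) (inCode w)

    value₃-at-parity : ∀ {b} w → odd w ≡ b → value₃ (colour₃ w) ≡ (if b then codeValue k w else x)
    value₃-at-parity w refl with odd w | inCode w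
    ... | false | _     = refl
    ... | true  | true  = refl
    ... | true  | false = refl

    open-at-even : ∀ v → odd v ≡ false → nbrSum m (value₃ ∘ colour₃) v ≡ k mod n
    open-at-even v even = ≡⇒≡mod (trans
      (nbrSum-cong-oppositeParity v λ w opposite → value₃-at-parity w (trans opposite (cong not even)))
      (nbrSum-codeValue k v))

    open-at-odd : ∀ v → odd v ≡ true → nbrSum m (value₃ ∘ colour₃) v ≡ k mod n
    open-at-odd (j ∷ u) odd-v = ≡mod-trans (≡⇒≡mod (trans
      (nbrSum-cong-oppositeParity (j ∷ u) λ w opposite → value₃-at-parity w (trans opposite (cong not odd-v)))
      constant-sum)) x-solves
      where
      constant-sum : nbrSum m (λ _ → x) (j ∷ u) ≡ + suc m * x
      constant-sum = trans (cong (_+ x) (sumFin-const m x)) (trans (ℤ.+-comm (+ m * x) x) (sym (ℤ.suc-* (+ m) x)))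

    threePattern : Pattern 3
    threePattern = record
      { colour            = colour₃
      ; value             = value₃
      ; adjacent-distinct = λ v i → label₃-flip (odd v) _ _
      ; open-colouring    = λ v → ≡mod⇒∣ (open-at v)
      }
      where
      open-at : ∀ v → nbrSum m (value₃ ∘ colour₃) v ≡ k mod n
      open-at v with odd v in parity
      ... | false = open-at-even v parity
      ... | true  = open-at-odd v parity

  χ≡3 : ¬ + n ∣ k → Pattern 3 → ChiIs n k m 3
  χ≡3 n∤k P = pattern₃⇒colouring n∤k P , λ _ _ → order≥3 n∤k

  χ≡4 : ¬ + n ∣ k → ¬ FiniteScheme → ChiIs n k m 4
  χ≡4 n∤k no-scheme =
    (lifted fourPattern , lifted-proper-open fourPattern , lifted-order fourPattern fourPattern-surjective) ,
    λ _ _ poc order → ℕ.≤∧≢⇒< (order≥3 n∤k poc order)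
                                λ { refl → pattern⇒¬¬finiteScheme (patternOf poc order) no-scheme }

theorem6p10 : (k : ℤ) (n m : ℕ) → 2 ≤ n → ¬ ((+ n) ∣ k) → 1 ≤ m →
    ((+ gcd (ℕ.suc m) n) ∣ k → ChiIs n k m 3)
    × (¬ ((+ gcd (ℕ.suc m) n) ∣ k) → ChiIs n k m 3 ⊎ ChiIs n k m 4)
theorem6p10 k n@(suc _) m@(suc m′) (s≤s _) n∤k (s≤s _) = three-if-gcd∣k , λ _ → three-or-four
  where
  open Colourings n k m′
  three-if-gcd∣k : + gcd (suc m) n ∣ k → ChiIs n k m 3
  three-if-gcd∣k gcd∣k = let (x , x-solves) = linear-congruence (suc m) n k gcd∣k in
    χ≡3 n∤k (threePattern x x-solves)
  three-or-four : ChiIs n k m 3 ⊎ ChiIs n k m 4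
  three-or-four = Sum.map (χ≡3 n∤k ∘ finiteScheme⇒pattern) (χ≡4 n∤k) (toSum finiteScheme?)
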